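{- Let $H$ be an $n$-vertex 3-uniform hypergraph that does not contain $C_4$ as a trace, let $A$ be the set of edges of $H$ containing at least one pair of co-degree $1$ in $H$, and let $B=H\setminus A$. Fix a vertex $v$. Then \[\sum_{u \in N_1(v)} |V_u|\le n + 14\,d_B(v).\]
   Context: The co-degree $d_H(a,b)$ is the number of edges of $H$ containing $\{a,b\}$; $d_B(v)$ is the number of edges of $B$ containing $v$. $N_1(v)$ is the set of vertices $z\ne v$ lying in a common edge of $B$ with $v$; $N_2(v)$ is the set of vertices $z\notin N_1(v)\cup\{v\}$ lying in an edge of $B$ that meets $N_1(v)$. For $u\in N_1(v)$, $E_u=\{e\in B: e\cap N_1(v)=\{u\}\}$ and $V_u=\{z\in N_2(v):\exists e\in E_u,\ z\in e\}$. $H$ contains $C_4$ as a trace if there exist distinct vertices $a_1,\dots,a_4$ and four distinct edges $f_1,\dots,f_4$ of $H$ with $f_i\cap\{a_1,\dots,a_4\}=\{a_i,a_{i+1}\}$ (indices mod 4). -}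

module Defs where

open import Data.Nat using (ℕ; _+_; _≡ᵇ_)
open import Data.Bool using (Bool; true; false; _∧_; _∨_; not; if_then_else_)
open import Data.Fin using (Fin; _≟_)
open import Data.Fin.Subset using (Subset; ∣_∣)
open import Data.Vec using (lookup)
open import Data.List using (List; length; filterᵇ; allFin; map)
open import Data.Bool.ListAction using (any; all)
open import Data.Nat.ListAction using (sum)
open import Data.List.Membership.Propositional using (_∈_)
open import Data.List.Relation.Unary.All using (All)
open import Data.List.Relation.Unary.Unique.Propositional using (Unique)
open import Data.Product using (Σ; _×_)
open import Relation.Nullary using (¬_; does)
open import Relation.Binary.PropositionalEquality using (_≡_; _≢_)

Hypergraph : ℕ → Set
Hypergraph n = List (Subset n)

Is3Uniform : ∀ {n} → Hypergraph n → Set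
Is3Uniform H = Unique H × All (λ e → ∣ e ∣ ≡ 3) H

module _ {n : ℕ} where

  mem : Fin n → Subset n → Bool
  mem x e = lookup e x

  eqF : Fin n → Fin n → Bool
  eqF a b = does (a ≟ b)

  card : (Fin n → Bool) → ℕ
  card p = length (filterᵇ p (allFin n))

  codeg : Hypergraph n → Fin n → Fin n → ℕ
  codeg H a b = length (filterᵇ (λ e → mem a e ∧ mem b e) H)

  inA : Hypergraph n → Subset n → Bool
  inA H e = any (λ a → any (λ b →
              not (eqF a b) ∧ mem a e ∧ mem b e ∧ (codeg H a b ≡ᵇ 1))
              (allFin n)) (allFin n)

  Bpart : Hypergraph n → Hypergraph n
  Bpart H = filterᵇ (λ e → not (inA H e)) H

  degB : Hypergraph n → Fin n → ℕ
  degB H v = length (filterᵇ (mem v) (Bpart H))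

  N1 : Hypergraph n → Fin n → Fin n → Bool
  N1 H v z = not (eqF z v) ∧ any (λ e → mem v e ∧ mem z e) (Bpart H)

  N2 : Hypergraph n → Fin n → Fin n → Bool
  N2 H v z = not (N1 H v z) ∧ not (eqF z v)
             ∧ any (λ e → mem z e ∧ any (λ w → N1 H v w ∧ mem w e) (allFin n))
                   (Bpart H)

  -- e ∈ E_u : e ∈ B and e ∩ N_1(v) = {u}   (membership in B checked by the caller)
  inEu : Hypergraph n → Fin n → Fin n → Subset n → Bool
  inEu H v u e = all (λ w → does ((mem w e ∧ N1 H v w) Data.Bool.≟ eqF w u)) (allFin n)

  Vu : Hypergraph n → Fin n → Fin n → Fin n → Bool
  Vu H v u z = N2 H v z ∧ any (λ e → inEu H v u e ∧ mem z e) (Bpart H)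

  sumVu : Hypergraph n → Fin n → ℕ
  sumVu H v = sum (map (λ u → if N1 H v u then card (Vu H v u) else 0) (allFin n))

  -- H contains C_4 as a trace: distinct a₁..a₄, distinct edges f₁..f₄ of H with
  -- fᵢ ∩ {a₁,…,a₄} = {aᵢ, aᵢ₊₁} (indices mod 4)
  record TraceC4 (H : Hypergraph n) : Set where
    field
      a₁ a₂ a₃ a₄ : Fin n
      f₁ f₂ f₃ f₄ : Subset n
      a₁₂ : a₁ ≢ a₂
      a₁₃ : a₁ ≢ a₃
      a₁₄ : a₁ ≢ a₄
      a₂₃ : a₂ ≢ a₃
      a₂₄ : a₂ ≢ a₄
      a₃₄ : a₃ ≢ a₄
      f₁∈ : f₁ ∈ H
      f₂∈ : f₂ ∈ H
      f₃∈ : f₃ ∈ H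
      f₄∈ : f₄ ∈ H
      f₁₂ : f₁ ≢ f₂
      f₁₃ : f₁ ≢ f₃
      f₁₄ : f₁ ≢ f₄
      f₂₃ : f₂ ≢ f₃
      f₂₄ : f₂ ≢ f₄
      f₃₄ : f₃ ≢ f₄
      t₁ : (mem a₁ f₁ ≡ true) × (mem a₂ f₁ ≡ true) × (mem a₃ f₁ ≡ false) × (mem a₄ f₁ ≡ false)
      t₂ : (mem a₁ f₂ ≡ false) × (mem a₂ f₂ ≡ true) × (mem a₃ f₂ ≡ true) × (mem a₄ f₂ ≡ false)
      t₃ : (mem a₁ f₃ ≡ false) × (mem a₂ f₃ ≡ false) × (mem a₃ f₃ ≡ true) × (mem a₄ f₃ ≡ true)
      t₄ : (mem a₁ f₄ ≡ true) × (mem a₂ f₄ ≡ false) × (mem a₃ f₄ ≡ false) × (mem a₄ f₄ ≡ true)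

-- Exchanging the order of summation, Σ_u |V_u| counts every z by its owners: the u ∈ N₁(v)
-- with z ∈ V_u. If u and u' both own z, C₄-freeness (no square v u z u') forces every B-edge
-- through v and u to contain u', or vice versa; hence z has at most two owners, and two owners
-- lie in a common B-edge {v, a, b}. So the sum is at most n plus, over the d_B(v) edges {v, a, b}
-- at v, the size of V_a ∩ V_b. Fix z₀ ∈ V_a ∩ V_b. Any other z ∈ V_a ∩ V_b lies in the edge
-- witnessing z₀ ∈ V_a or the one witnessing z₀ ∈ V_b (two candidates each), or is anchored at
-- z₀ on one side (every edge of E_a through z passes through z₀, or the same for b), since
-- otherwise a square a z b z₀ appears. Repeating the argument inside the anchored vertices
-- bounds each side by 2 + 2 + 1, so |V_a ∩ V_b| ≤ 2 + 2 + 5 + 5 = 14.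
module Submission where

open import Defs
open import Data.Nat using (ℕ; _≤_; _+_; _*_)
open import Data.Fin using (Fin)
open import Relation.Nullary using (¬_)

open import Data.Nat using (zero; suc; z≤n; s≤s; s≤s⁻¹; _≤?_)
open import Data.Nat.Properties
  using (≤-refl; ≤-trans; ≤-reflexive; +-mono-≤; +-monoʳ-≤; m≤m+n; m≤n+m; +-suc; *-comm;
         suc-injective; ≰⇒>; +-0-commutativeMonoid; module ≤-Reasoning)
open import Data.Fin using (zero; suc; _≟_)
open import Data.Bool using (Bool; true; false; _∧_; _∨_; not; if_then_else_) renaming (_≟_ to _≟ᵇ_)
open import Data.Bool.Properties
  using (∧-conicalˡ; ∧-conicalʳ; ∧-identityʳ; ∧-comm; not-injective; ¬-not)
open import Data.Vec using ([]; _∷_)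
open import Data.Fin.Subset using (Subset; ∣_∣)
open import Data.List using (List; []; _∷_; length; lookup; filterᵇ; allFin; map; tabulate)
open import Data.List.Properties using (map-tabulate)
open import Data.Bool.ListAction using (any; all)
open import Data.Nat.ListAction using (sum)
open import Data.List.Membership.Propositional using (_∈_)
open import Data.List.Membership.Propositional.Properties using (∈-allFin; ∈-lookup)
open import Data.List.Relation.Unary.Any using (here; there; index)
open import Data.List.Relation.Unary.Any.Properties using (lookup-index)
open import Data.List.Relation.Unary.All as All using (All; []; _∷_)
open import Data.List.Relation.Unary.Unique.Propositional using (Unique; []; _∷_)
open import Function using (_∘_; id)
open import Data.Product using (∃-syntax; _×_; _,_; proj₁; proj₂)
open import Data.Sum using (_⊎_; inj₁; inj₂; map₂)
open import Data.Empty using (⊥; ⊥-elim)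
open import Relation.Nullary using (does; yes; no)
open import Relation.Nullary.Decidable using (dec-true; dec-false)
open import Relation.Binary.PropositionalEquality
  using (_≡_; _≢_; refl; sym; trans; cong; cong₂; subst; ≢-sym; module ≡-Reasoning)
open import Algebra.Properties.CommutativeMonoid.Sum +-0-commutativeMonoid
  using (sum-syntax; ∑-distrib-+; ∑-comm; sum-cong-≗; sum-replicate-zero)

𝟙 : Bool → ℕ
𝟙 b = if b then 1 else 0

𝟙-true : ∀ {b} → b ≡ true → 𝟙 b ≡ 1
𝟙-true refl = refl

∨-true⁺ : ∀ {a b} → a ≡ true ⊎ b ≡ true → a ∨ b ≡ true
∨-true⁺ (inj₁ refl) = refl
∨-true⁺ {true} (inj₂ refl) = refl
∨-true⁺ {false} (inj₂ refl) = refl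

𝟙-∨ : ∀ a b → 𝟙 (a ∨ b) ≤ 𝟙 a + 𝟙 b
𝟙-∨ true b = s≤s z≤n
𝟙-∨ false b = ≤-refl

true≢false : true ≢ false
true≢false ()

⇒-true⁻ : ∀ {a b c} → not (a ∧ b) ∨ c ≡ true → a ≡ true → b ≡ true → c ≡ true
⇒-true⁻ q refl refl = q

⇒-false⁻ : ∀ {a b c} → not (a ∧ b) ∨ c ≡ false → a ≡ true × b ≡ true × c ≡ false
⇒-false⁻ {true} {true} {false} _ = refl , refl , refl

module _ {n : ℕ} where

  eqF-false⁻ : {x y : Fin n} → eqF x y ≡ false → x ≢ y
  eqF-false⁻ {x} {y} p with x ≟ y
  ... | no x≢y = x≢y

  eqF-refl : (x : Fin n) → eqF x x ≡ true
  eqF-refl x = dec-true (x ≟ x) refl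

  ≢⇒not-eqF : {x y : Fin n} → x ≢ y → not (eqF x y) ≡ true
  ≢⇒not-eqF {x} {y} x≢y = cong not (dec-false (x ≟ y) x≢y)

  not-eqF⇒≢ : {x y : Fin n} → not (eqF x y) ≡ true → x ≢ y
  not-eqF⇒≢ p = eqF-false⁻ (not-injective p)

eqF-suc : ∀ {n} (x y : Fin n) → eqF (suc x) (suc y) ≡ eqF x y
eqF-suc x y with x ≟ y
... | yes refl = refl
... | no _ = refl

module _ {A : Set} where

  any-true⁺ : (p : A → Bool) {x : A} {xs : List A} → x ∈ xs → p x ≡ true → any p xs ≡ true
  any-true⁺ p (here refl) q rewrite q = refl
  any-true⁺ p {xs = y ∷ ys} (there m) q with p y
  ... | true = refl
  ... | false = any-true⁺ p m q

  any-true⁻ : (p : A → Bool) (xs : List A) → any p xs ≡ true → ∃[ x ] x ∈ xs × p x ≡ true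
  any-true⁻ p (y ∷ ys) q with p y in eq
  ... | true = y , here refl , eq
  ... | false with any-true⁻ p ys q
  ... | x , m , r = x , there m , r

  all-true⁻ : (p : A → Bool) {x : A} {xs : List A} → all p xs ≡ true → x ∈ xs → p x ≡ true
  all-true⁻ p {xs = y ∷ ys} q (here refl) = ∧-conicalˡ _ _ q
  all-true⁻ p {xs = y ∷ ys} q (there m) = all-true⁻ p (∧-conicalʳ _ _ q) m

  all-false⁻ : (p : A → Bool) (xs : List A) → all p xs ≡ false → ∃[ x ] x ∈ xs × p x ≡ false
  all-false⁻ p (y ∷ ys) q with p y in eq
  ... | false = y , here refl , eq
  ... | true with all-false⁻ p ys q
  ... | x , m , r = x , there m , r

  filterᵇ-true⁻ : (p : A → Bool) {x : A} (xs : List A) → x ∈ filterᵇ p xs → x ∈ xs × p x ≡ true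
  filterᵇ-true⁻ p (y ∷ ys) m with p y in eq
  filterᵇ-true⁻ p (y ∷ ys) (here refl) | true = here refl , eq
  filterᵇ-true⁻ p (y ∷ ys) (there m) | true with filterᵇ-true⁻ p ys m
  ... | m′ , px = there m′ , px
  filterᵇ-true⁻ p (y ∷ ys) m | false with filterᵇ-true⁻ p ys m
  ... | m′ , px = there m′ , px

  filterᵇ-true⁺ : (p : A → Bool) {x : A} {xs : List A} → x ∈ xs → p x ≡ true → x ∈ filterᵇ p xs
  filterᵇ-true⁺ p {xs = y ∷ ys} (here refl) q rewrite q = here refl
  filterᵇ-true⁺ p {xs = y ∷ ys} (there m) q with p y
  ... | true = there (filterᵇ-true⁺ p m q)
  ... | false = filterᵇ-true⁺ p m q

∑-mono-≤ : ∀ {n} {f g : Fin n → ℕ} → (∀ i → f i ≤ g i) → ∑[ i < n ] f i ≤ ∑[ i < n ] g i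
∑-mono-≤ {zero} f≤g = z≤n
∑-mono-≤ {suc n} f≤g = +-mono-≤ (f≤g zero) (∑-mono-≤ (λ i → f≤g (suc i)))

∑-bounded : ∀ {n c} {f : Fin n → ℕ} → (∀ i → f i ≤ c) → ∑[ i < n ] f i ≤ n * c
∑-bounded {zero} f≤c = z≤n
∑-bounded {suc n} f≤c = +-mono-≤ (f≤c zero) (∑-bounded (λ i → f≤c (suc i)))

∑-1 : ∀ n → ∑[ i < n ] 1 ≡ n
∑-1 zero = refl
∑-1 (suc n) = cong suc (∑-1 n)

term≤∑ : ∀ {n} (f : Fin n → ℕ) i → f i ≤ ∑[ j < n ] f j
term≤∑ f zero = m≤m+n _ _
term≤∑ f (suc i) = ≤-trans (term≤∑ (λ j → f (suc j)) i) (m≤n+m _ (f zero))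

sum-map-allFin : ∀ {n} (f : Fin n → ℕ) → sum (map f (allFin n)) ≡ ∑[ i < n ] f i
sum-map-allFin {zero} f = refl
sum-map-allFin {suc n} f = cong (f zero +_) (begin
    sum (map f (tabulate suc))              ≡⟨ cong sum (map-tabulate suc f) ⟩
    sum (tabulate (f ∘ suc))                ≡⟨ cong sum (sym (map-tabulate id (f ∘ suc))) ⟩
    sum (map (f ∘ suc) (allFin n))          ≡⟨ sum-map-allFin (f ∘ suc) ⟩
    ∑[ i < n ] f (suc i)                    ∎)
  where open ≡-Reasoning

module _ {n : ℕ} where

  count : (Fin n → Bool) → ℕ
  count p = ∑[ x < n ] 𝟙 (p x)

  _∖_ : (Fin n → Bool) → Fin n → Fin n → Bool
  (p ∖ a) x = p x ∧ not (eqF x a)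

count-mono : ∀ {n} {p q : Fin n → Bool} → (∀ x → p x ≡ true → q x ≡ true) → count p ≤ count q
count-mono {p = p} {q} p⇒q = ∑-mono-≤ pointwise
  where
  pointwise : ∀ x → 𝟙 (p x) ≤ 𝟙 (q x)
  pointwise x with p x in px
  ... | false = z≤n
  ... | true rewrite p⇒q x px = ≤-refl

count-∨ : ∀ {n} (p q : Fin n → Bool) → count (λ x → p x ∨ q x) ≤ count p + count q
count-∨ p q = ≤-trans (∑-mono-≤ (λ x → 𝟙-∨ (p x) (q x)))
                      (≤-reflexive (∑-distrib-+ (λ x → 𝟙 (p x)) (λ x → 𝟙 (q x))))

count-cover : ∀ {n} {p : Fin n → Bool} (q r : Fin n → Bool) →
  (∀ x → p x ≡ true → q x ≡ true ⊎ r x ≡ true) → count p ≤ count q + count r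
count-cover q r cover = ≤-trans (count-mono (λ x px → ∨-true⁺ (cover x px))) (count-∨ q r)

count-cover₃ : ∀ {n} {p : Fin n → Bool} (q r s : Fin n → Bool) →
  (∀ x → p x ≡ true → q x ≡ true ⊎ r x ≡ true ⊎ s x ≡ true) →
  count p ≤ count q + (count r + count s)
count-cover₃ q r s cover =
  ≤-trans (count-cover q (λ x → r x ∨ s x) (λ x px → map₂ ∨-true⁺ (cover x px)))
          (+-monoʳ-≤ (count q) (count-∨ r s))

count-cover₄ : ∀ {n} {p : Fin n → Bool} (q r s t : Fin n → Bool) →
  (∀ x → p x ≡ true → q x ≡ true ⊎ r x ≡ true ⊎ s x ≡ true ⊎ t x ≡ true) →
  count p ≤ count q + (count r + (count s + count t))
count-cover₄ q r s t cover =
  ≤-trans (count-cover₃ q r (λ x → s x ∨ t x) (λ x px → map₂ (map₂ ∨-true⁺) (cover x px)))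
          (+-monoʳ-≤ (count q) (+-monoʳ-≤ (count r) (count-∨ s t)))

count-pos : ∀ {n} (p : Fin n → Bool) → 1 ≤ count p → ∃[ x ] p x ≡ true
count-pos {suc n} p h with p zero in p0
... | true = zero , p0
... | false with count-pos (λ x → p (suc x)) h
... | x , px = suc x , px

count-∖ : ∀ {n} (p : Fin n → Bool) {a} → p a ≡ true → count p ≡ suc (count (p ∖ a))
count-∖ {suc n} p {zero} pa rewrite pa =
  cong suc (sum-cong-≗ λ x → cong 𝟙 (sym (∧-identityʳ (p (suc x)))))
count-∖ {suc n} p {suc a} pa = begin
    𝟙 (p zero) + count (p ∘ suc)              ≡⟨ cong (𝟙 (p zero) +_) (count-∖ (p ∘ suc) pa) ⟩
    𝟙 (p zero) + suc (count ((p ∘ suc) ∖ a))  ≡⟨ +-suc _ _ ⟩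
    suc (𝟙 (p zero) + count ((p ∘ suc) ∖ a))  ≡⟨ cong suc (cong₂ _+_ head-kept tail-same) ⟩
    suc (count (p ∖ suc a))                   ∎
  where
  open ≡-Reasoning
  head-kept : 𝟙 (p zero) ≡ 𝟙 (p zero ∧ not (eqF zero (suc a)))
  head-kept = cong 𝟙 (sym (∧-identityʳ _))
  tail-same : count ((p ∘ suc) ∖ a) ≡ ∑[ x < n ] 𝟙 ((p ∖ suc a) (suc x))
  tail-same = sum-cong-≗ λ x → cong (λ b → 𝟙 (p (suc x) ∧ not b)) (sym (eqF-suc x a))

distinct≤count : ∀ {n} (p : Fin n → Bool) {xs : List (Fin n)} →
  Unique xs → All (λ x → p x ≡ true) xs → length xs ≤ count p
distinct≤count p [] [] = z≤n
distinct≤count p (x∉xs ∷ unique) (px ∷ pxs) rewrite count-∖ p px =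
  s≤s (distinct≤count (p ∖ _) unique (All.zipWith kept (pxs , x∉xs)))
  where
  kept : ∀ {y} → p y ≡ true × _ ≢ y → (p ∖ _) y ≡ true
  kept (py , x≢y) = cong₂ _∧_ py (≢⇒not-eqF (≢-sym x≢y))

distinct-witnesses : ∀ {n} (p : Fin n → Bool) k → k ≤ count p →
  ∃[ xs ] length xs ≡ k × Unique xs × All (λ x → p x ≡ true) xs
distinct-witnesses p zero _ = [] , refl , [] , []
distinct-witnesses p (suc k) k<count with count-pos p (≤-trans (s≤s z≤n) k<count)
... | x , px with distinct-witnesses (p ∖ x) k (s≤s⁻¹ (subst (suc k ≤_) (count-∖ p px) k<count))
... | xs , refl , unique , pxs =
  x ∷ xs , refl , All.map (λ q → ≢-sym (not-eqF⇒≢ (∧-conicalʳ _ _ q))) pxs ∷ unique ,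
  px ∷ All.map (∧-conicalˡ _ _) pxs

count≤ : ∀ {n} (p : Fin n → Bool) k →
  (∀ xs → length xs ≡ suc k → Unique xs → All (λ x → p x ≡ true) xs → ⊥) → count p ≤ k
count≤ p k no-witnesses with suc k ≤? count p
... | yes k<count with distinct-witnesses p (suc k) k<count
...   | xs , len , unique , pxs = ⊥-elim (no-witnesses xs len unique pxs)
count≤ p k no-witnesses | no k≮count = s≤s⁻¹ (≰⇒> k≮count)

count≤-from-witness : ∀ {n} (p : Fin n → Bool) k → (∀ x → p x ≡ true → count p ≤ k) → count p ≤ k
count≤-from-witness p k bound with 1 ≤? count p
... | yes 0<count = bound _ (proj₂ (count-pos p 0<count))
... | no 0≮count = ≤-trans (s≤s⁻¹ (≰⇒> 0≮count)) z≤n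

∣∣≡count : ∀ {n} (e : Subset n) → ∣ e ∣ ≡ count (λ x → mem x e)
∣∣≡count [] = refl
∣∣≡count (true ∷ e) = cong suc (∣∣≡count e)
∣∣≡count (false ∷ e) = ∣∣≡count e

length-filterᵇ-tabulate : ∀ {A : Set} {m} (p : A → Bool) (g : Fin m → A) →
  length (filterᵇ p (tabulate g)) ≡ count (λ i → p (g i))
length-filterᵇ-tabulate {m = zero} p g = refl
length-filterᵇ-tabulate {m = suc m} p g with p (g zero)
... | true = cong suc (length-filterᵇ-tabulate p (λ i → g (suc i)))
... | false = length-filterᵇ-tabulate p (λ i → g (suc i))

card≡count : ∀ {n} (p : Fin n → Bool) → card p ≡ count p
card≡count p = length-filterᵇ-tabulate p (λ x → x)

module Neighbourhood {n : ℕ} (H : Hypergraph n) (uniform : Is3Uniform H) (C4-free : ¬ TraceC4 H)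
                     (v : Fin n) where

  B : Hypergraph n
  B = Bpart H

  N₁ N₂ : Fin n → Bool
  N₁ = N1 H v
  N₂ = N2 H v

  E : Fin n → Subset n → Bool
  E u e = inEu H v u e

  V : Fin n → Fin n → Bool
  V u z = Vu H v u z

  members : Subset n → Fin n → Bool
  members e x = mem x e

  B⊆H : ∀ {e} → e ∈ B → e ∈ H
  B⊆H e∈B = proj₁ (filterᵇ-true⁻ _ H e∈B)

  count-members : ∀ {e} → e ∈ B → count (members e) ≡ 3
  count-members {e} e∈B = trans (sym (∣∣≡count e)) (All.lookup (proj₂ uniform) (B⊆H e∈B))

  no-four-members : ∀ {e a b c d} → e ∈ B →
    a ≢ b → a ≢ c → a ≢ d → b ≢ c → b ≢ d → c ≢ d →
    mem a e ≡ true → mem b e ≡ true → mem c e ≡ true → mem d e ≡ true → ⊥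
  no-four-members {e} e∈B a≢b a≢c a≢d b≢c b≢d c≢d ae be ce de
    with ≤-trans (distinct≤count (members e)
                   ((a≢b ∷ a≢c ∷ a≢d ∷ []) ∷ (b≢c ∷ b≢d ∷ []) ∷ (c≢d ∷ []) ∷ [] ∷ [])
                   (ae ∷ be ∷ ce ∷ de ∷ []))
                 (≤-reflexive (count-members e∈B))
  ... | s≤s (s≤s (s≤s ()))

  count-others : ∀ {e a} → e ∈ B → mem a e ≡ true → count (members e ∖ a) ≡ 2
  count-others {e} e∈B ae = suc-injective (trans (sym (count-∖ (members e) ae)) (count-members e∈B))

  two-others : ∀ {e a} → e ∈ B → mem a e ≡ true →
    ∃[ b ] ∃[ c ] b ≢ c × b ≢ a × c ≢ a × mem b e ≡ true × mem c e ≡ true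
  two-others {e} {a} e∈B ae
    with distinct-witnesses (members e ∖ a) 2 (≤-reflexive (sym (count-others e∈B ae)))
  ... | b ∷ c ∷ [] , refl , (b≢c ∷ []) ∷ _ , pb ∷ pc ∷ [] =
    b , c , b≢c , not-eqF⇒≢ (∧-conicalʳ _ _ pb) , not-eqF⇒≢ (∧-conicalʳ _ _ pc) ,
    ∧-conicalˡ _ _ pb , ∧-conicalˡ _ _ pc

  N₁⁻ : ∀ {u} → N₁ u ≡ true → u ≢ v × ∃[ g ] g ∈ B × mem v g ≡ true × mem u g ≡ true
  N₁⁻ {u} p with any-true⁻ (λ e → mem v e ∧ mem u e) B (∧-conicalʳ (not (eqF u v)) _ p)
  ... | g , g∈B , vug =
    not-eqF⇒≢ (∧-conicalˡ _ _ p) , g , g∈B , ∧-conicalˡ _ _ vug , ∧-conicalʳ (mem v g) _ vug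

  N₁⁺ : ∀ {z g} → z ≢ v → g ∈ B → mem v g ≡ true → mem z g ≡ true → N₁ z ≡ true
  N₁⁺ {z} z≢v g∈B vg zg =
    cong₂ _∧_ (≢⇒not-eqF z≢v) (any-true⁺ (λ e → mem v e ∧ mem z e) g∈B (cong₂ _∧_ vg zg))

  N₁⇒≢v : ∀ {u} → N₁ u ≡ true → v ≢ u
  N₁⇒≢v p = ≢-sym (proj₁ (N₁⁻ p))

  N₂⇒¬N₁ : ∀ {z} → N₂ z ≡ true → N₁ z ≡ false
  N₂⇒¬N₁ p = not-injective (∧-conicalˡ _ _ p)

  N₂⇒≢v : ∀ {z} → N₂ z ≡ true → z ≢ v
  N₂⇒≢v {z} p = not-eqF⇒≢ (∧-conicalˡ _ _ (∧-conicalʳ (not (N₁ z)) _ p))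

  N₁-N₂-disjoint : ∀ {u z} → N₁ u ≡ true → N₂ z ≡ true → u ≢ z
  N₁-N₂-disjoint p q refl = true≢false (trans (sym p) (N₂⇒¬N₁ q))

  N₂-not-beside-v : ∀ {z g} → N₂ z ≡ true → g ∈ B → mem v g ≡ true → mem z g ≡ true → ⊥
  N₂-not-beside-v p g∈B vg zg = true≢false (trans (sym (N₁⁺ (N₂⇒≢v p) g∈B vg zg)) (N₂⇒¬N₁ p))

  record EdgeOf (u : Fin n) (e : Subset n) : Set where
    field
      ∈B : e ∈ B
      ∋u : mem u e ≡ true
      ∈E : E u e ≡ true
      u∈N₁ : N₁ u ≡ true
      ∌N₁ : ∀ {w} → N₁ w ≡ true → w ≢ u → mem w e ≡ false

  E⇒EdgeOf : ∀ {u e} → e ∈ B → E u e ≡ true → EdgeOf u e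
  E⇒EdgeOf {u} {e} e∈B p = record
    { ∈B = e∈B
    ; ∈E = p
    ; ∋u = ∧-conicalˡ _ _ u-marked
    ; u∈N₁ = ∧-conicalʳ (mem u e) _ u-marked
    ; ∌N₁ = λ {w} w∈N₁ w≢u → ¬-not λ we → true≢false
        (trans (cong₂ _∧_ (sym we) (sym w∈N₁)) (trans (marked w) (dec-false (w ≟ u) w≢u)))
    }
    where
    does-≟⇒≡ : ∀ {x y : Bool} → does (x ≟ᵇ y) ≡ true → x ≡ y
    does-≟⇒≡ {true} {true} _ = refl
    does-≟⇒≡ {false} {false} _ = refl
    marked : ∀ w → (mem w e ∧ N₁ w) ≡ eqF w u
    marked w =
      does-≟⇒≡ (all-true⁻ (λ w → does ((mem w e ∧ N₁ w) ≟ᵇ eqF w u)) p (∈-allFin w))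
    u-marked : mem u e ∧ N₁ u ≡ true
    u-marked = trans (marked u) (eqF-refl u)

  record InV (u z : Fin n) : Set where
    field
      z∈N₂ : N₂ z ≡ true
      edge : Subset n
      edgeOf : EdgeOf u edge
      ∋z : mem z edge ≡ true

  V⁻ : ∀ u z → V u z ≡ true → InV u z
  V⁻ u z p with any-true⁻ (λ e → E u e ∧ mem z e) B (∧-conicalʳ (N₂ z) _ p)
  ... | e , e∈B , q = record
    { z∈N₂ = ∧-conicalˡ _ _ p
    ; edge = e
    ; edgeOf = E⇒EdgeOf e∈B (∧-conicalˡ _ _ q)
    ; ∋z = ∧-conicalʳ (E u e) _ q
    }

  open EdgeOf
  open InV

  separated : ∀ {x : Fin n} {e e'} → mem x e ≡ true → mem x e' ≡ false → e ≢ e'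
  separated p q refl = true≢false (trans (sym p) q)

  N₂-avoids-edges-at-v : ∀ {z g} → N₂ z ≡ true → g ∈ B → mem v g ≡ true → mem z g ≡ false
  N₂-avoids-edges-at-v p g∈B vg = ¬-not (N₂-not-beside-v p g∈B vg)

  edges-at-N₂-avoid-v : ∀ {z g} → N₂ z ≡ true → g ∈ B → mem z g ≡ true → mem v g ≡ false
  edges-at-N₂-avoid-v p g∈B zg = ¬-not λ vg → N₂-not-beside-v p g∈B vg zg

  no-square-across : ∀ {a b z w e e' f f'} → a ≢ b → z ≢ w → N₂ z ≡ true → N₂ w ≡ true →
    EdgeOf a e → EdgeOf b e' → EdgeOf b f' → EdgeOf a f →
    mem z e ≡ true → mem z e' ≡ true → mem w f' ≡ true → mem w f ≡ true →
    mem w e ≡ false → mem w e' ≡ false → mem z f' ≡ false → mem z f ≡ false → ⊥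
  no-square-across {a} {b} {z} {w} {e} {e'} {f} {f'} a≢b z≢w z∈N₂ w∈N₂ ae be' bf' af
                   ze ze' wf' wf we we' zf' zf = C4-free record
    { a₁ = a ; a₂ = z ; a₃ = b ; a₄ = w
    ; f₁ = e ; f₂ = e' ; f₃ = f' ; f₄ = f
    ; a₁₂ = N₁-N₂-disjoint (u∈N₁ ae) z∈N₂ ; a₁₃ = a≢b ; a₁₄ = N₁-N₂-disjoint (u∈N₁ ae) w∈N₂
    ; a₂₃ = ≢-sym (N₁-N₂-disjoint (u∈N₁ be') z∈N₂) ; a₂₄ = z≢w ; a₃₄ = N₁-N₂-disjoint (u∈N₁ be') w∈N₂
    ; f₁∈ = B⊆H (∈B ae) ; f₂∈ = B⊆H (∈B be') ; f₃∈ = B⊆H (∈B bf') ; f₄∈ = B⊆H (∈B af)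
    ; f₁₂ = separated (∋u ae) a∉e' ; f₁₃ = separated (∋u ae) a∉f' ; f₁₄ = separated ze zf
    ; f₂₃ = separated ze' zf' ; f₂₄ = separated (∋u be') b∉f ; f₃₄ = separated (∋u bf') b∉f
    ; t₁ = ∋u ae , ze , b∉e , we
    ; t₂ = a∉e' , ze' , ∋u be' , we'
    ; t₃ = a∉f' , zf' , ∋u bf' , wf'
    ; t₄ = ∋u af , zf , b∉f , wf
    }
    where
    a∉e' = ∌N₁ be' (u∈N₁ ae) a≢b
    a∉f' = ∌N₁ bf' (u∈N₁ ae) a≢b
    b∉e = ∌N₁ ae (u∈N₁ be') (≢-sym a≢b)
    b∉f = ∌N₁ af (u∈N₁ be') (≢-sym a≢b)

  no-square-through-v : ∀ {u u' z e e' g g'} → u ≢ u' → N₂ z ≡ true →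
    EdgeOf u e → EdgeOf u' e' → mem z e ≡ true → mem z e' ≡ true →
    g ∈ B → mem v g ≡ true → mem u g ≡ true → mem u' g ≡ false →
    g' ∈ B → mem v g' ≡ true → mem u' g' ≡ true → mem u g' ≡ false → ⊥
  no-square-through-v {u} {u'} {z} {e} {e'} {g} {g'} u≢u' z∈N₂ ue u'e' ze ze'
                      g∈B vg ug u'∉g g'∈B vg' u'g' u∉g' = C4-free record
    { a₁ = v ; a₂ = u ; a₃ = z ; a₄ = u'
    ; f₁ = g ; f₂ = e ; f₃ = e' ; f₄ = g'
    ; a₁₂ = N₁⇒≢v (u∈N₁ ue) ; a₁₃ = ≢-sym (N₂⇒≢v z∈N₂) ; a₁₄ = N₁⇒≢v (u∈N₁ u'e')
    ; a₂₃ = N₁-N₂-disjoint (u∈N₁ ue) z∈N₂ ; a₂₄ = u≢u'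
    ; a₃₄ = ≢-sym (N₁-N₂-disjoint (u∈N₁ u'e') z∈N₂)
    ; f₁∈ = B⊆H g∈B ; f₂∈ = B⊆H (∈B ue) ; f₃∈ = B⊆H (∈B u'e') ; f₄∈ = B⊆H g'∈B
    ; f₁₂ = separated vg v∉e ; f₁₃ = separated vg v∉e' ; f₁₄ = separated ug u∉g'
    ; f₂₃ = separated (∋u ue) u∉e' ; f₂₄ = separated (∋u ue) u∉g' ; f₃₄ = separated ze' z∉g'
    ; t₁ = vg , ug , z∉g , u'∉g
    ; t₂ = v∉e , ∋u ue , ze , ∌N₁ ue (u∈N₁ u'e') (≢-sym u≢u')
    ; t₃ = v∉e' , u∉e' , ze' , ∋u u'e'
    ; t₄ = vg' , u∉g' , z∉g' , u'g'
    }
    where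
    z∉g = N₂-avoids-edges-at-v z∈N₂ g∈B vg
    z∉g' = N₂-avoids-edges-at-v z∈N₂ g'∈B vg'
    v∉e = edges-at-N₂-avoid-v z∈N₂ (∈B ue) ze
    v∉e' = edges-at-N₂-avoid-v z∈N₂ (∈B u'e') ze'
    u∉e' = ∌N₁ u'e' (u∈N₁ ue) u≢u'

  Dominates : Fin n → Fin n → Set
  Dominates u u' = ∀ {g} → g ∈ B → mem v g ≡ true → mem u g ≡ true → mem u' g ≡ true

  dominates-trans : ∀ {a b c} → Dominates a b → Dominates b c → Dominates a c
  dominates-trans a⇝b b⇝c g∈B vg ag = b⇝c g∈B vg (a⇝b g∈B vg ag)

  dominates? : ∀ u u' →
    Dominates u u' ⊎ ∃[ g ] g ∈ B × mem v g ≡ true × mem u g ≡ true × mem u' g ≡ false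
  dominates? u u' with all (λ g → not (mem v g ∧ mem u g) ∨ mem u' g) B in check
  ... | true = inj₁ λ g∈B vg ug → ⇒-true⁻ (all-true⁻ _ check g∈B) vg ug
  ... | false with all-false⁻ _ B check
  ... | g , g∈B , q = inj₂ (g , g∈B , ⇒-false⁻ q)

  comparable : ∀ {u u' z} → u ≢ u' → InV u z → InV u' z → Dominates u u' ⊎ Dominates u' u
  comparable {u} {u'} u≢u' zu zu' with dominates? u u' | dominates? u' u
  ... | inj₁ u⇝u' | _ = inj₁ u⇝u'
  ... | inj₂ _ | inj₁ u'⇝u = inj₂ u'⇝u
  ... | inj₂ (g , g∈B , vg , ug , u'∉g) | inj₂ (g' , g'∈B , vg' , u'g' , u∉g') =
    ⊥-elim (no-square-through-v u≢u' (z∈N₂ zu) (edgeOf zu) (edgeOf zu') (∋z zu) (∋z zu')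
                                g∈B vg ug u'∉g g'∈B vg' u'g' u∉g')

  Owner : Fin n → Fin n → Bool
  Owner z u = N₁ u ∧ V u z

  owner⁻ : ∀ z u → Owner z u ≡ true → InV u z
  owner⁻ z u p = V⁻ u z (∧-conicalʳ (N₁ u) _ p)

  no-dominating-owner : ∀ {z a b c} → InV a z → InV b z → InV c z →
    Dominates a b → Dominates a c → a ≢ b → a ≢ c → b ≢ c → ⊥
  no-dominating-owner {z} za zb zc a⇝b a⇝c a≢b a≢c b≢c with N₁⁻ (u∈N₁ (edgeOf za))
  ... | _ , g , g∈B , vg , ag =
    no-four-members g∈B (v≢ za) (v≢ zb) (v≢ zc) a≢b a≢c b≢c vg ag (a⇝b g∈B vg ag) (a⇝c g∈B vg ag)
    where
    v≢ : ∀ {u} → InV u z → v ≢ u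
    v≢ zu = N₁⇒≢v (u∈N₁ (edgeOf zu))

  -- Dominates is transitive and total on the owners of z, so one of three owners dominates the others.
  no-three-owners : ∀ {z x y w} → x ≢ y → x ≢ w → y ≢ w → InV x z → InV y z → InV w z → ⊥
  no-three-owners x≢y x≢w y≢w zx zy zw with comparable x≢y zx zy | comparable x≢w zx zw
  ... | inj₁ x⇝y | inj₁ x⇝w = no-dominating-owner zx zy zw x⇝y x⇝w x≢y x≢w y≢w
  ... | inj₁ x⇝y | inj₂ w⇝x =
    no-dominating-owner zw zx zy w⇝x (dominates-trans w⇝x x⇝y) (≢-sym x≢w) (≢-sym y≢w) x≢y
  ... | inj₂ y⇝x | inj₁ x⇝w =
    no-dominating-owner zy zx zw y⇝x (dominates-trans y⇝x x⇝w) (≢-sym x≢y) y≢w x≢w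
  ... | inj₂ y⇝x | inj₂ w⇝x with comparable y≢w zy zw
  ...   | inj₁ y⇝w = no-dominating-owner zy zx zw y⇝x y⇝w (≢-sym x≢y) y≢w x≢w
  ...   | inj₂ w⇝y = no-dominating-owner zw zx zy w⇝x w⇝y (≢-sym x≢w) (≢-sym y≢w) x≢y

  owners≤2 : ∀ z → count (Owner z) ≤ 2
  owners≤2 z = count≤ (Owner z) 2 λ where
    (x ∷ y ∷ w ∷ []) refl ((x≢y ∷ x≢w ∷ []) ∷ (y≢w ∷ []) ∷ _) (px ∷ py ∷ pw ∷ []) →
      no-three-owners x≢y x≢w y≢w (owner⁻ z x px) (owner⁻ z y py) (owner⁻ z w pw)

  owners-share-edge-at-v : ∀ {z u u'} → u ≢ u' → InV u z → InV u' z →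
    ∃[ g ] g ∈ B × mem v g ≡ true × mem u g ≡ true × mem u' g ≡ true
  owners-share-edge-at-v u≢u' zu zu' with comparable u≢u' zu zu'
  ... | inj₁ u⇝u' with N₁⁻ (u∈N₁ (edgeOf zu))
  ...   | _ , g , g∈B , vg , ug = g , g∈B , vg , ug , u⇝u' g∈B vg ug
  owners-share-edge-at-v u≢u' zu zu' | inj₂ u'⇝u with N₁⁻ (u∈N₁ (edgeOf zu'))
  ...   | _ , g , g∈B , vg , u'g = g , g∈B , vg , u'⇝u g∈B vg u'g , u'g

  edges-at-v : List (Subset n)
  edges-at-v = filterᵇ (mem v) B

  SharedBy : Fin n → Subset n → Fin n → Fin n → Bool
  SharedBy z e u u' = not (eqF u u') ∧ (Owner z u ∧ (Owner z u' ∧ (mem u e ∧ mem u' e)))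

  Shared : Fin n → Subset n → Bool
  Shared z e = any (λ u → any (SharedBy z e u) (allFin n)) (allFin n)

  shared⁺ : ∀ {z u u' e} → u ≢ u' → Owner z u ≡ true → Owner z u' ≡ true →
    mem u e ≡ true → mem u' e ≡ true → Shared z e ≡ true
  shared⁺ {z} {u} {u'} {e} u≢u' pu pu' ue u'e =
    any-true⁺ (λ x → any (SharedBy z e x) (allFin n)) (∈-allFin u)
      (any-true⁺ (SharedBy z e u) (∈-allFin u')
        (cong₂ _∧_ (≢⇒not-eqF u≢u') (cong₂ _∧_ pu (cong₂ _∧_ pu' (cong₂ _∧_ ue u'e)))))

  shared⁻ : ∀ z e → Shared z e ≡ true → ∃[ u ] ∃[ u' ] u ≢ u' ×
    Owner z u ≡ true × Owner z u' ≡ true × mem u e ≡ true × mem u' e ≡ true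
  shared⁻ z e p with any-true⁻ _ (allFin n) p
  ... | u , _ , q with any-true⁻ _ (allFin n) q
  ... | u' , _ , r = u , u' , not-eqF⇒≢ (∧-conicalˡ _ _ r) ,
                     ∧-conicalˡ _ _ r₁ , ∧-conicalˡ _ _ r₂ , ∧-conicalˡ _ _ r₃ , ∧-conicalʳ (mem u e) _ r₃
    where
    r₁ = ∧-conicalʳ (not (eqF u u')) _ r
    r₂ = ∧-conicalʳ (Owner z u) _ r₁
    r₃ = ∧-conicalʳ (Owner z u') _ r₂

  deg : ℕ
  deg = length edges-at-v

  shared-at : Fin n → Fin deg → ℕ
  shared-at z i = 𝟙 (Shared z (lookup edges-at-v i))

  -- A vertex with two owners is charged to an edge at v containing both.
  owners-bound : ∀ z → count (Owner z) ≤ 1 + ∑[ i < deg ] shared-at z i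
  owners-bound z with 2 ≤? count (Owner z)
  ... | no ≱2 = ≤-trans (s≤s⁻¹ (≰⇒> ≱2)) (m≤m+n 1 _)
  ... | yes ≥2 with distinct-witnesses (Owner z) 2 ≥2
  ...   | u ∷ u' ∷ [] , refl , (u≢u' ∷ []) ∷ _ , pu ∷ pu' ∷ []
        with owners-share-edge-at-v u≢u' (owner⁻ z u pu) (owner⁻ z u' pu')
  ...     | g , g∈B , vg , ug , u'g = ≤-trans (owners≤2 z) (s≤s (begin
            1                               ≡⟨ sym (𝟙-true shared-at-i) ⟩
            shared-at z i                   ≤⟨ term≤∑ (shared-at z) i ⟩
            ∑[ j < deg ] shared-at z j      ∎))
    where
    open ≤-Reasoning
    g∈edges-at-v : g ∈ edges-at-v
    g∈edges-at-v = filterᵇ-true⁺ (mem v) g∈B vg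
    i : Fin deg
    i = index g∈edges-at-v
    shared-at-i : Shared z (lookup edges-at-v i) ≡ true
    shared-at-i = subst (λ e → Shared z e ≡ true) (lookup-index g∈edges-at-v)
                        (shared⁺ {z} {e = g} u≢u' pu pu' ug u'g)

  apart : ∀ {x y : Fin n} {e} → mem x e ≡ false → mem y e ≡ true → x ≢ y
  apart p q refl = true≢false (trans (sym q) p)

  N₂-edge-excludes : ∀ {a e z z' w} → EdgeOf a e → N₂ z ≡ true → N₂ z' ≡ true → N₂ w ≡ true →
    z ≢ z' → z ≢ w → z' ≢ w → mem z e ≡ true → mem z' e ≡ true → mem w e ≡ false
  N₂-edge-excludes ae z∈N₂ z'∈N₂ w∈N₂ z≢z' z≢w z'≢w ze z'e = ¬-not λ we →
    no-four-members (∈B ae) (a≢ z∈N₂) (a≢ z'∈N₂) (a≢ w∈N₂) z≢z' z≢w z'≢w (∋u ae) ze z'e we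
    where
    a≢ : ∀ {x} → N₂ x ≡ true → _ ≢ x
    a≢ = N₁-N₂-disjoint (u∈N₁ ae)

  others-in-edge : ∀ {a e z} → EdgeOf a e → N₂ z ≡ true → mem z e ≡ true → (members e ∖ a) z ≡ true
  others-in-edge {a} {e} {z} ae z∈N₂ ze =
    cong₂ _∧_ ze (≢⇒not-eqF {x = z} {y = a} (≢-sym (N₁-N₂-disjoint (u∈N₁ ae) z∈N₂)))

  count-others-in-edge : ∀ {a e} → EdgeOf a e → count (members e ∖ a) ≤ 2
  count-others-in-edge ae = ≤-reflexive (count-others (∈B ae) (∋u ae))

  Common : Fin n → Fin n → Fin n → Bool
  Common a b z = V a z ∧ V b z

  Pinned : Fin n → Fin n → Fin n → Bool
  Pinned a z z₀ = all (λ e → not (E a e ∧ mem z e) ∨ mem z₀ e) B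

  pinned⁻ : ∀ {a z z₀ e} → Pinned a z z₀ ≡ true → EdgeOf a e → mem z e ≡ true → mem z₀ e ≡ true
  pinned⁻ p ae ze = ⇒-true⁻ (all-true⁻ _ p (∈B ae)) (∈E ae) ze

  pinned-false⁻ : ∀ a z z₀ → Pinned a z z₀ ≡ false →
    ∃[ e ] EdgeOf a e × mem z e ≡ true × mem z₀ e ≡ false
  pinned-false⁻ a z z₀ p with all-false⁻ _ B p
  ... | e , e∈B , q with ⇒-false⁻ q
  ...   | ae , ze , z₀∉e = e , E⇒EdgeOf e∈B ae , ze , z₀∉e

  Anchored : Fin n → Fin n → Fin n → Fin n → Bool
  Anchored a b z₀ z = Common a b z ∧ (not (eqF z z₀) ∧ Pinned a z z₀)

  record IsAnchored (a b z₀ z : Fin n) : Set where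
    field
      za : InV a z
      zb : InV b z
      ≢anchor : z ≢ z₀
      pinned : Pinned a z z₀ ≡ true

  anchored⁻ : ∀ a b z₀ z → Anchored a b z₀ z ≡ true → IsAnchored a b z₀ z
  anchored⁻ a b z₀ z p = record
    { za = V⁻ a z (∧-conicalˡ _ _ common)
    ; zb = V⁻ b z (∧-conicalʳ (V a z) _ common)
    ; ≢anchor = not-eqF⇒≢ (∧-conicalˡ _ _ rest)
    ; pinned = ∧-conicalʳ (not (eqF z z₀)) _ rest
    }
    where
    common = ∧-conicalˡ _ _ p
    rest = ∧-conicalʳ (Common a b z) _ p

  anchored⁺ : ∀ {a b z₀ z} → Common a b z ≡ true → z ≢ z₀ → Pinned a z z₀ ≡ true →
    Anchored a b z₀ z ≡ true
  anchored⁺ common z≢z₀ pinned = cong₂ _∧_ common (cong₂ _∧_ (≢⇒not-eqF z≢z₀) pinned)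

  open IsAnchored

  common-swap : ∀ {a b z} → Common a b z ≡ true → Common b a z ≡ true
  common-swap {a} {b} {z} p = trans (∧-comm (V b z) (V a z)) p

  anchor-excludes : ∀ {a b z₀ z w} → (A : IsAnchored a b z₀ z) → N₂ z₀ ≡ true → N₂ w ≡ true →
    z ≢ w → w ≢ z₀ → mem w (edge (za A)) ≡ false
  anchor-excludes A z₀∈N₂ w∈N₂ z≢w w≢z₀ =
    N₂-edge-excludes (edgeOf (za A)) (z∈N₂ (za A)) z₀∈N₂ w∈N₂ (≢anchor A) z≢w (≢-sym w≢z₀)
                     (∋z (za A)) (pinned⁻ (pinned A) (edgeOf (za A)) (∋z (za A)))

  DoublyAnchored : Fin n → Fin n → Fin n → Fin n → Fin n → Bool
  DoublyAnchored a b z₀ z₁ z = Anchored a b z₀ z ∧ Anchored b a z₁ z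

  doubly-anchored≤1 : ∀ {a b z₀ z₁} → a ≢ b → N₂ z₀ ≡ true → N₂ z₁ ≡ true →
    count (DoublyAnchored a b z₀ z₁) ≤ 1
  doubly-anchored≤1 {a} {b} {z₀} {z₁} a≢b z₀∈N₂ z₁∈N₂ = count≤ _ 1 λ where
    (x ∷ y ∷ []) refl ((x≢y ∷ []) ∷ _) (px ∷ py ∷ []) →
      let Ax = anchored⁻ a b z₀ x (∧-conicalˡ _ _ px)
          Bx = anchored⁻ b a z₁ x (∧-conicalʳ (Anchored a b z₀ x) _ px)
          Ay = anchored⁻ a b z₀ y (∧-conicalˡ _ _ py)
          By = anchored⁻ b a z₁ y (∧-conicalʳ (Anchored a b z₀ y) _ py)
          x∈N₂ = z∈N₂ (za Ax)
          y∈N₂ = z∈N₂ (za Ay)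
      in no-square-across a≢b x≢y x∈N₂ y∈N₂
           (edgeOf (za Ax)) (edgeOf (za Bx)) (edgeOf (za By)) (edgeOf (za Ay))
           (∋z (za Ax)) (∋z (za Bx)) (∋z (za By)) (∋z (za Ay))
           (anchor-excludes Ax z₀∈N₂ y∈N₂ x≢y (≢anchor Ay))
           (anchor-excludes Bx z₁∈N₂ y∈N₂ x≢y (≢anchor By))
           (anchor-excludes By z₁∈N₂ x∈N₂ (≢-sym x≢y) (≢anchor Bx))
           (anchor-excludes Ay z₀∈N₂ x∈N₂ (≢-sym x≢y) (≢anchor Ax))

  anchored-cover : ∀ {a b z₀ z₁} → a ≢ b → N₂ z₀ ≡ true → (A₁ : IsAnchored a b z₀ z₁) →
    ∀ z → Anchored a b z₀ z ≡ true →
    (members (edge (za A₁)) ∖ a) z ≡ true ⊎ (members (edge (zb A₁)) ∖ b) z ≡ true ⊎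
    DoublyAnchored a b z₀ z₁ z ≡ true
  anchored-cover {a} {b} {z₀} {z₁} a≢b z₀∈N₂ A₁ z p
    with anchored⁻ a b z₀ z p | mem z (edge (za A₁)) ≟ᵇ true | mem z (edge (zb A₁)) ≟ᵇ true
  ... | A | yes ze₁ | _ = inj₁ (others-in-edge (edgeOf (za A₁)) (z∈N₂ (za A)) ze₁)
  ... | A | no _ | yes ze₁' = inj₂ (inj₁ (others-in-edge (edgeOf (zb A₁)) (z∈N₂ (za A)) ze₁'))
  ... | A | no z∉e₁ | no z∉e₁'
    with apart {e = edge (za A₁)} (¬-not z∉e₁) (∋z (za A₁)) | Pinned b z z₁ ≟ᵇ true
  ...   | z≢z₁ | yes pinned-b =
    inj₂ (inj₂ (cong₂ _∧_ p
      (anchored⁺ (common-swap {a} {b} {z} (∧-conicalˡ _ _ p)) z≢z₁ pinned-b)))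
  ...   | z≢z₁ | no not-pinned-b with pinned-false⁻ b z z₁ (¬-not not-pinned-b)
  ...     | e' , be' , ze' , z₁∉e' =
    ⊥-elim (no-square-across a≢b z≢z₁ (z∈N₂ (za A)) (z∈N₂ (za A₁))
              (edgeOf (za A)) be' (edgeOf (zb A₁)) (edgeOf (za A₁))
              (∋z (za A)) ze' (∋z (zb A₁)) (∋z (za A₁))
              (anchor-excludes A z₀∈N₂ (z∈N₂ (za A₁)) z≢z₁ (≢anchor A₁)) z₁∉e'
              (¬-not z∉e₁') (¬-not z∉e₁))

  anchored≤5 : ∀ {a b z₀} → a ≢ b → N₂ z₀ ≡ true → count (Anchored a b z₀) ≤ 5
  anchored≤5 {a} {b} {z₀} a≢b z₀∈N₂ = count≤-from-witness _ 5 λ z₁ p₁ →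
    let A₁ = anchored⁻ a b z₀ z₁ p₁
    in ≤-trans (count-cover₃ _ _ _ (anchored-cover a≢b z₀∈N₂ A₁))
               (+-mono-≤ (count-others-in-edge (edgeOf (za A₁)))
                 (+-mono-≤ (count-others-in-edge (edgeOf (zb A₁)))
                   (doubly-anchored≤1 a≢b z₀∈N₂ (z∈N₂ (za A₁)))))

  common-cover : ∀ {a b z₀} → a ≢ b → (z₀a : InV a z₀) (z₀b : InV b z₀) →
    ∀ z → Common a b z ≡ true →
    (members (edge z₀a) ∖ a) z ≡ true ⊎ (members (edge z₀b) ∖ b) z ≡ true ⊎
    Anchored a b z₀ z ≡ true ⊎ Anchored b a z₀ z ≡ true
  common-cover {a} {b} {z₀} a≢b z₀a z₀b z p
    with V⁻ a z (∧-conicalˡ _ _ p) | mem z (edge z₀a) ≟ᵇ true | mem z (edge z₀b) ≟ᵇ true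
  ... | za | yes ze₀ | _ = inj₁ (others-in-edge (edgeOf z₀a) (z∈N₂ za) ze₀)
  ... | za | no _ | yes ze₀' = inj₂ (inj₁ (others-in-edge (edgeOf z₀b) (z∈N₂ za) ze₀'))
  ... | za | no z∉e₀ | no z∉e₀'
    with apart {e = edge z₀a} (¬-not z∉e₀) (∋z z₀a)
       | Pinned a z z₀ ≟ᵇ true | Pinned b z z₀ ≟ᵇ true
  ...   | z≢z₀ | yes pinned-a | _ = inj₂ (inj₂ (inj₁ (anchored⁺ p z≢z₀ pinned-a)))
  ...   | z≢z₀ | no _ | yes pinned-b =
    inj₂ (inj₂ (inj₂ (anchored⁺ (common-swap {a} {b} {z} p) z≢z₀ pinned-b)))
  ...   | z≢z₀ | no not-pinned-a | no not-pinned-b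
    with pinned-false⁻ a z z₀ (¬-not not-pinned-a) | pinned-false⁻ b z z₀ (¬-not not-pinned-b)
  ...     | e , ae , ze , z₀∉e | e' , be' , ze' , z₀∉e' =
    ⊥-elim (no-square-across a≢b z≢z₀ (z∈N₂ za) (z∈N₂ z₀a) ae be' (edgeOf z₀b) (edgeOf z₀a)
              ze ze' (∋z z₀b) (∋z z₀a) z₀∉e z₀∉e' (¬-not z∉e₀') (¬-not z∉e₀))

  common≤14 : ∀ {a b} → a ≢ b → count (Common a b) ≤ 14
  common≤14 {a} {b} a≢b = count≤-from-witness _ 14 λ z₀ p₀ →
    let z₀a = V⁻ a z₀ (∧-conicalˡ _ _ p₀)
        z₀b = V⁻ b z₀ (∧-conicalʳ (V a z₀) _ p₀)
    in ≤-trans (count-cover₄ _ _ _ _ (common-cover a≢b z₀a z₀b))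
               (+-mono-≤ (count-others-in-edge (edgeOf z₀a))
                 (+-mono-≤ (count-others-in-edge (edgeOf z₀b))
                   (+-mono-≤ (anchored≤5 a≢b (z∈N₂ z₀a)) (anchored≤5 (≢-sym a≢b) (z∈N₂ z₀a)))))

  edge-shared≤14 : ∀ {e} → e ∈ edges-at-v → count (λ z → Shared z e) ≤ 14
  edge-shared≤14 {e} e∈edges-at-v with filterᵇ-true⁻ (mem v) B e∈edges-at-v
  ... | e∈B , ve with two-others e∈B ve
  ...   | a , b , a≢b , a≢v , b≢v , ae , be = ≤-trans (count-mono shared⇒common) (common≤14 a≢b)
    where
    a-or-b : ∀ {x} → mem x e ≡ true → x ≢ v → x ≡ a ⊎ x ≡ b
    a-or-b {x} xe x≢v with x ≟ a | x ≟ b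
    ... | yes x≡a | _ = inj₁ x≡a
    ... | no _ | yes x≡b = inj₂ x≡b
    ... | no x≢a | no x≢b = ⊥-elim (no-four-members e∈B (≢-sym a≢v) (≢-sym b≢v) (≢-sym x≢v)
                                      a≢b (≢-sym x≢a) (≢-sym x≢b) ve ae be xe)
    shared⇒common : ∀ z → Shared z e ≡ true → Common a b z ≡ true
    shared⇒common z p with shared⁻ z e p
    ... | u , u' , u≢u' , pu , pu' , ue , u'e =
      pick (a-or-b ue (≢-sym (N₁⇒≢v (∧-conicalˡ _ _ pu))))
           (a-or-b u'e (≢-sym (N₁⇒≢v (∧-conicalˡ _ _ pu'))))
      where
      zu = ∧-conicalʳ (N₁ u) _ pu
      zu' = ∧-conicalʳ (N₁ u') _ pu'
      pick : u ≡ a ⊎ u ≡ b → u' ≡ a ⊎ u' ≡ b → Common a b z ≡ true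
      pick (inj₁ refl) (inj₁ refl) = ⊥-elim (u≢u' refl)
      pick (inj₁ refl) (inj₂ refl) = cong₂ _∧_ zu zu'
      pick (inj₂ refl) (inj₁ refl) = cong₂ _∧_ zu' zu
      pick (inj₂ refl) (inj₂ refl) = ⊥-elim (u≢u' refl)

  shared≤14 : ∀ i → ∑[ z < n ] shared-at z i ≤ 14
  shared≤14 i = edge-shared≤14 (∈-lookup i)

  sumVu≡∑owners : sumVu H v ≡ ∑[ z < n ] count (Owner z)
  sumVu≡∑owners = begin
    sumVu H v                                    ≡⟨ sum-map-allFin (λ u → if N₁ u then card (V u) else 0) ⟩
    ∑[ u < n ] (if N₁ u then card (V u) else 0)  ≡⟨ sum-cong-≗ per-u ⟩
    ∑[ u < n ] ∑[ z < n ] 𝟙 (Owner z u)          ≡⟨ ∑-comm (λ u z → 𝟙 (Owner z u)) ⟩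
    ∑[ z < n ] count (Owner z)                   ∎
    where
    open ≡-Reasoning
    per-u : ∀ u → (if N₁ u then card (V u) else 0) ≡ ∑[ z < n ] 𝟙 (Owner z u)
    per-u u with N₁ u
    ... | true = card≡count (V u)
    ... | false = sym (sum-replicate-zero n)

lemma6p4 : (n : ℕ) (H : Hypergraph n) → Is3Uniform H → ¬ TraceC4 H →
           (v : Fin n) → sumVu H v ≤ n + 14 * degB H v
lemma6p4 n H uniform C4-free v = begin
    sumVu H v                                             ≡⟨ sumVu≡∑owners ⟩
    ∑[ z < n ] count (Owner z)                            ≤⟨ ∑-mono-≤ owners-bound ⟩
    ∑[ z < n ] (1 + ∑[ i < deg ] shared-at z i)           ≡⟨ ∑-distrib-+ (λ _ → 1) charged ⟩
    ∑[ z < n ] 1 + ∑[ z < n ] ∑[ i < deg ] shared-at z i  ≡⟨ cong₂ _+_ (∑-1 n) (∑-comm shared-at) ⟩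
    n + ∑[ i < deg ] ∑[ z < n ] shared-at z i             ≤⟨ +-monoʳ-≤ n (∑-bounded shared≤14) ⟩
    n + deg * 14                                          ≡⟨ cong (n +_) (*-comm deg 14) ⟩
    n + 14 * degB H v                                     ∎
  where
  open Neighbourhood H uniform C4-free v
  open ≤-Reasoning
  charged : Fin n → ℕ
  charged z = ∑[ i < deg ] shared-at z i
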